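{- Let $t\ge 1$ and let $G_t$ be the multigraph with edges $u_iv_i$, $1\le i\le t$, produced by the semi-random graph process under any strategy. If $H$ is a Hamiltonian cycle in $G_t$, then the total number of squares used by $H$ is at most $Z-|\mathcal W_1|-|\mathcal W_2|+W$.
   Context: Semi-random graph process on $[n]$: in step $i$ a uniformly random vertex $u_i\in[n]$ is presented and a strategy chooses $v_i\in[n]\setminus\{u_i\}$; edge $u_iv_i$ is added. Call $u_i$ the square and $v_i$ the circle of step $i$; a square/circle "lands on" vertex $x$ if $u_i=x$ (resp. $v_i=x$). Each edge of $G_t$ corresponds to a step $i$, and a Hamiltonian cycle $H$ (a set of $n$ such edges forming a cycle through all vertices) uses the square $u_i$ of each of its edges $u_iv_i$. Let $Z_x$ be the number of squares landing on $x$ among steps $1,\dots,t$, and $Z=\sum_{x=1}^n(\mathbf 1_{Z_x=1}+2\cdot\mathbf 1_{Z_x\ge 2})$. Let $\mathcal W_1$ be the set of pairs $(x,y)$ such that: (a) $x$ receives its first square at some step $i<t$ and $y=v_i$ is the circle of that step; (b) no further squares land on $x$ after step $i$ (up to step $t$); (c) at least two squares land on $y$ after step $i$ (up to step $t$). Let $\mathcal W_2$ be the set of pairs $(x,y)$ such that: (a) $x=u_i$ and $y=v_i$ for some step $i<t$; (b) $x$ receives exactly two squares in steps $1,\dots,t$; (c) at least two squares land on $y$ after step $i$ (up to step $t$). Let $\mathcal T_1=\{((x_1,y_1),(x_2,y_2))\in\mathcal W_1\times\mathcal W_2: y_1=x_2\}$, $\mathcal T_2=\{((x_1,y_1),(x_2,y_2))\in\mathcal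 W_2\times\mathcal W_2: y_1=x_2\}$, and $W=|\mathcal T_1|+|\mathcal T_2|$. -}

module Defs where

open import Data.Nat using (ℕ; zero; suc; _+_; _≤_; _<_; NonZero)
open import Data.Nat.DivMod using (_%_; m%n<n)
open import Data.Bool using (Bool; true; false; _∧_; _∨_; not; if_then_else_)
open import Data.Fin using (Fin; toℕ; fromℕ<; _≟_)
open import Data.Fin.Properties using () renaming (_≟_ to _≟ᶠ_)
open import Data.List using (List; length; filter; map)
open import Data.Bool.ListAction using (any)
open import Data.Nat.ListAction using (sum)
open import Function.Definitions using (Injective; Surjective)
open import Relation.Binary.PropositionalEquality using (_≡_)
open import Data.Sum using (_⊎_)
open import Data.List using () renaming (allFin to allFinL)
open import Data.Product using (_×_; _,_)
open import Relation.Nullary.Decidable using (⌊_⌋)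
import Data.Nat as N

count : {m : ℕ} → (Fin m → Bool) → ℕ
count {m} p = length (filter (λ i → Data.Bool.T? (p i)) (allFinL m))
  where import Data.Bool

_==_ : {m : ℕ} → Fin m → Fin m → Bool
a == b = ⌊ a ≟ b ⌋

_<ᵇ_ : {m : ℕ} → Fin m → Fin m → Bool
i <ᵇ j = ⌊ toℕ i N.<? toℕ j ⌋

next : {n : ℕ} → Fin n → Fin n
next {suc m} k = fromℕ< (m%n<n (suc (toℕ k)) (suc m))

-- A run of the semi-random process for t steps on vertex set Fin n:
-- step i (i : Fin t, steps numbered 0..t-1) has square u i and circle v i.
module Process {n t : ℕ} (u v : Fin t → Fin n) where

  Zx : Fin n → ℕ
  Zx x = count (λ i → u i == x)

  zval : ℕ → ℕ
  zval 0 = 0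
  zval 1 = 1
  zval (suc (suc _)) = 2

  Z : ℕ
  Z = sum (map (λ x → zval (Zx x)) (allFinL n))

  after : Fin t → Fin n → ℕ
  after i y = count (λ j → (i <ᵇ j) ∧ (u j == y))

  -- step i is not the last step (i < t in 1-based numbering)
  notLast : Fin t → Bool
  notLast i = ⌊ suc (toℕ i) N.<? t ⌋

  atLeast2 : ℕ → Bool
  atLeast2 k = ⌊ 2 N.≤? k ⌋

  inW1 : Fin n → Fin n → Bool
  inW1 x y = any (λ i → notLast i ∧ (u i == x) ∧ (v i == y)
                        ∧ not (any (λ j → (j <ᵇ i) ∧ (u j == x)) (allFinL t))
                        ∧ ⌊ after i x N.≟ 0 ⌋
                        ∧ atLeast2 (after i y))
                 (allFinL t)

  inW2 : Fin n → Fin n → Bool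
  inW2 x y = any (λ i → notLast i ∧ (u i == x) ∧ (v i == y)
                        ∧ ⌊ Zx x N.≟ 2 ⌋
                        ∧ atLeast2 (after i y))
                 (allFinL t)

  countPairs : (Fin n → Fin n → Bool) → ℕ
  countPairs p = sum (map (λ x → count (p x)) (allFinL n))

  W1size W2size : ℕ
  W1size = countPairs inW1
  W2size = countPairs inW2

  countQuads : (Fin n → Fin n → Fin n → Fin n → Bool) → ℕ
  countQuads p = sum (map (λ x₁ → sum (map (λ y₁ → sum (map (λ x₂ → count (p x₁ y₁ x₂)) (allFinL n))) (allFinL n))) (allFinL n))

  T1size T2size W : ℕ
  T1size = countQuads (λ x₁ y₁ x₂ y₂ → inW1 x₁ y₁ ∧ inW2 x₂ y₂ ∧ (y₁ == x₂))
  T2size = countQuads (λ x₁ y₁ x₂ y₂ → inW2 x₁ y₁ ∧ inW2 x₂ y₂ ∧ (y₁ == x₂))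
  W = T1size + T2size

  joins : Fin t → Fin n → Fin n → Set
  joins i a b = (u i ≡ a × v i ≡ b) ⊎ (u i ≡ b × v i ≡ a)

-- A Hamiltonian cycle of the multigraph G_t: a cyclic ordering w of all
-- vertices (a bijection Fin n → Fin n) together with n distinct steps e k,
-- where step e k is an edge between w k and w (next k).
record HamCycle {n t : ℕ} (u v : Fin t → Fin n) : Set where
  field
    w     : Fin n → Fin n
    w-inj : Injective _≡_ _≡_ w
    w-sur : Surjective _≡_ _≡_ w
    e     : Fin n → Fin t
    e-inj : Injective _≡_ _≡_ e
    e-ok  : ∀ k → Process.joins u v (e k) (w k) (w (next k))

squaresUsed : {n t : ℕ} {u v : Fin t → Fin n} → HamCycle u v → ℕ
squaresUsed {n} {t} {u} {v} H = sum (map (λ x → count (λ k → u (HamCycle.e H k) == x)) (allFinL n))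

-- Charge every pair (x, y) of W₁ ∪ W₂ to one vertex: to x if its step is not an edge of H,
-- and to y if it is.  At a vertex z, the squares of H on z and the pairs charged to z as first
-- coordinate occupy distinct squares landing on z, so there are at most Z_z of them; the pairs
-- charged to z as second coordinate use H-edges with circle z, and together with the H-edges
-- with square z there are at most two such edges.  As a W₁-pair (x, y) forces Z_x ≤ 1, a
-- W₂-pair forces Z_x = 2, and both force Z_y ≥ 2, the load of z is at most
-- 1[Z_z = 1] + 2·1[Z_z ≥ 2], except when Z_z = 2 and z has both an unused W₂-pair (z, y) and a
-- used pair (x, z); the excess is then at most the number of chains ((x, z), (z, y)) in
-- T₁ ∪ T₂.

module Submission where

open import Defs
open import Data.Nat using (ℕ; _+_; _≤_)
open import Data.Fin using (Fin)
open import Relation.Binary.PropositionalEquality using (_≢_)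

open import Data.Bool using (Bool; true; false; T; T?; _∧_; _∨_; not)
open import Data.Bool.ListAction using (any)
open import Data.Empty using (⊥-elim)
open import Data.Fin using (zero; suc; toℕ)
import Data.Fin.Properties as Fin
open import Data.List using (List; []; _∷_; length; filter; map; tabulate; allFin)
open import Data.List.Properties using (map-tabulate)
open import Data.List.Membership.Propositional.Properties using (∈-allFin)
import Data.List.Relation.Unary.Any as Any
open import Data.List.Relation.Unary.Any.Properties using (any⁺; any⁻)
import Data.Nat as ℕ
open import Data.Nat using (suc; _*_; z≤n; s≤s)
open import Data.Nat.DivMod using (_%_; m≤n⇒m%n≡m; n%n≡0)
open import Data.Nat.ListAction using (sum)
open import Data.Nat.Properties
  using (+-*-semiring; +-comm; +-assoc; +-identityʳ; *-distribʳ-+; suc-injective; <-cmp; ≤⇒≯; n≤0⇒n≡0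
        ; ≤-refl; ≤-reflexive; ≤-trans; m≤m+n; m≤n⇒m≤o+n; m≤n⇒m≤n+o; m≤n⇒m<n∨m≡n; m≤m*n
        ; +-mono-≤; +-monoˡ-≤; +-monoʳ-≤; *-mono-≤; module ≤-Reasoning)
open import Data.Nat.Tactic.RingSolver using (solve-∀)
open import Algebra.Properties.Semiring.Sum +-*-semiring
  using (sum-syntax; sum-cong-≗; sum-replicate-zero; ∑-distrib-+; ∑-comm; *-distribʳ-sum)
open import Data.Product using (_×_; _,_; proj₁; proj₂; ∃-syntax)
open import Data.Sum using (_⊎_; inj₁; inj₂)
open import Function using (_∘_)
open import Relation.Binary.Definitions using (tri<; tri≈; tri>)
open import Relation.Binary.PropositionalEquality
open import Relation.Nullary using (¬_)
open import Relation.Nullary.Decidable using (⌊_⌋; toWitness; fromWitness)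

private
  variable
    m m′ : ℕ

-- Boolean predicates and counting on finite sets

∧-intro : ∀ {a b} → T a → T b → T (a ∧ b)
∧-intro {true} _ b = b

∧-elim : ∀ a {b} → T (a ∧ b) → T a × T b
∧-elim true b = _ , b

∨-elim : ∀ a {b} → T (a ∨ b) → T a ⊎ T b
∨-elim true  a = inj₁ a
∨-elim false b = inj₂ b

not⁺ : ∀ {b} → ¬ T b → T (not b)
not⁺ {false} _  = _
not⁺ {true}  ¬b = ¬b _

not⁻ : ∀ b → T (not b) → ¬ T b
not⁻ false _ ()

𝟙 : Bool → ℕ
𝟙 true  = 1
𝟙 false = 0

any-allFin⁻ : (p : Fin m → Bool) → T (any p (allFin m)) → ∃[ i ] T (p i)
any-allFin⁻ {m} p t = Any.satisfied (any⁻ p (allFin m) t)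

any-allFin⁺ : (p : Fin m → Bool) (i : Fin m) → T (p i) → T (any p (allFin m))
any-allFin⁺ p i pᵢ = any⁺ p (Any.map (λ { refl → pᵢ }) (∈-allFin i))

==⇒≡ : {a b : Fin m} → T (a == b) → a ≡ b
==⇒≡ = toWitness

≡⇒== : {a b : Fin m} → a ≡ b → T (a == b)
≡⇒== = fromWitness

sum-tabulate : ∀ {m} (f : Fin m → ℕ) → sum (tabulate f) ≡ ∑[ i < m ] f i
sum-tabulate {ℕ.zero} f = refl
sum-tabulate {suc m}  f = cong (f zero +_) (sum-tabulate (f ∘ suc))

sum-map-allFin : ∀ {m} (f : Fin m → ℕ) → sum (map f (allFin m)) ≡ ∑[ i < m ] f i
sum-map-allFin {m} f = trans (cong sum (map-tabulate (λ i → i) f)) (sum-tabulate f)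

length-filter≡sum-𝟙 : ∀ {A : Set} (p : A → Bool) (xs : List A) →
                      length (filter (T? ∘ p) xs) ≡ sum (map (𝟙 ∘ p) xs)
length-filter≡sum-𝟙 p [] = refl
length-filter≡sum-𝟙 p (x ∷ xs) with p x
... | true  = cong suc (length-filter≡sum-𝟙 p xs)
... | false = length-filter≡sum-𝟙 p xs

∑-mono : ∀ {m} {f g : Fin m → ℕ} → (∀ i → f i ≤ g i) → ∑[ i < m ] f i ≤ ∑[ i < m ] g i
∑-mono {ℕ.zero} f≤g = z≤n
∑-mono {suc m}  f≤g = +-mono-≤ (f≤g zero) (∑-mono (f≤g ∘ suc))

≤-∑ : ∀ {m} (f : Fin m → ℕ) (i : Fin m) → f i ≤ ∑[ j < m ] f j
≤-∑ f zero    = m≤m+n _ _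
≤-∑ f (suc i) = m≤n⇒m≤o+n (f zero) (≤-∑ (f ∘ suc) i)

∑-distrib-+₃ : (f g h : Fin m → ℕ) →
               ∑[ i < m ] (f i + g i + h i) ≡ ∑[ i < m ] f i + ∑[ i < m ] g i + ∑[ i < m ] h i
∑-distrib-+₃ f g h =
  trans (∑-distrib-+ (λ i → f i + g i) h) (cong (_+ ∑[ i < _ ] h i) (∑-distrib-+ f g))

count≡∑𝟙 : (p : Fin m → Bool) → count p ≡ ∑[ i < m ] 𝟙 (p i)
count≡∑𝟙 {m} p = trans (length-filter≡sum-𝟙 p (allFin m)) (sum-map-allFin (𝟙 ∘ p))

count+count : (p q : Fin m → Bool) → count p + count q ≡ ∑[ i < m ] (𝟙 (p i) + 𝟙 (q i))
count+count {m} p q = begin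
  count p + count q                          ≡⟨ cong₂ _+_ (count≡∑𝟙 p) (count≡∑𝟙 q) ⟩
  ∑[ i < m ] 𝟙 (p i) + ∑[ i < m ] 𝟙 (q i)   ≡⟨ ∑-distrib-+ (𝟙 ∘ p) (𝟙 ∘ q) ⟨
  ∑[ i < m ] (𝟙 (p i) + 𝟙 (q i))            ∎
  where open ≡-Reasoning

≤-count : (p : Fin m → Bool) (i : Fin m) → T (p i) → 1 ≤ count p
≤-count p i pᵢ with p i | ≤-∑ (𝟙 ∘ p) i
... | true | 1≤∑ = subst (1 ≤_) (sym (count≡∑𝟙 p)) 1≤∑

count≡0⇒¬ : (p : Fin m → Bool) → count p ≡ 0 → ∀ i → ¬ T (p i)
count≡0⇒¬ p count≡0 i pᵢ with () ← subst (1 ≤_) count≡0 (≤-count p i pᵢ)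

count-mono : {p q : Fin m → Bool} → (∀ {i} → T (p i) → T (q i)) → count p ≤ count q
count-mono {m} {p} {q} p⇒q = begin
  count p             ≡⟨ count≡∑𝟙 p ⟩
  ∑[ i < m ] 𝟙 (p i)  ≤⟨ ∑-mono (λ i → 𝟙-mono (p i) (q i) p⇒q) ⟩
  ∑[ i < m ] 𝟙 (q i)  ≡⟨ count≡∑𝟙 q ⟨
  count q             ∎
  where
  open ≤-Reasoning
  𝟙-mono : ∀ a b → (T a → T b) → 𝟙 a ≤ 𝟙 b
  𝟙-mono false _    _   = z≤n
  𝟙-mono true  true _   = ≤-refl
  𝟙-mono true  false a⇒b = ⊥-elim (a⇒b _)

count≡0 : (p : Fin m → Bool) → (∀ {i} → ¬ T (p i)) → count p ≡ 0
count≡0 {m} p ¬p = begin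
  count p             ≡⟨ count≡∑𝟙 p ⟩
  ∑[ i < m ] 𝟙 (p i)  ≡⟨ sum-cong-≗ (λ i → 𝟙≡0 (p i) ¬p) ⟩
  ∑[ i < m ] 0        ≡⟨ sum-replicate-zero m ⟩
  0                   ∎
  where
  open ≡-Reasoning
  𝟙≡0 : ∀ b → ¬ T b → 𝟙 b ≡ 0
  𝟙≡0 false _  = refl
  𝟙≡0 true  ¬b = ⊥-elim (¬b _)

count≤1 : {p : Fin m → Bool} → (∀ {i j} → T (p i) → T (p j) → i ≡ j) → count p ≤ 1
count≤1 {m} {p} unique = subst (_≤ 1) (sym (count≡∑𝟙 p)) (∑𝟙≤1 p unique)
  where
  ∑𝟙≤1 : ∀ {m} (p : Fin m → Bool) → (∀ {i j} → T (p i) → T (p j) → i ≡ j) → ∑[ i < m ] 𝟙 (p i) ≤ 1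
  ∑𝟙≤1 {ℕ.zero} p unique = z≤n
  ∑𝟙≤1 {suc m}  p unique with p zero in p₀
  ... | false = ∑𝟙≤1 (p ∘ suc) (λ pᵢ pⱼ → Fin.suc-injective (unique pᵢ pⱼ))
  ... | true  = ≤-reflexive (cong suc (trans (sym (count≡∑𝟙 (p ∘ suc))) (count≡0 (p ∘ suc) λ pᵢ₊₁ →
                  Fin.0≢1+n (unique (subst T (sym p₀) _) pᵢ₊₁))))

count-∧-split : (p q : Fin m → Bool) →
                count (λ i → p i ∧ q i) + count (λ i → p i ∧ not (q i)) ≡ count p
count-∧-split {m} p q = begin
  count (λ i → p i ∧ q i) + count (λ i → p i ∧ not (q i))  ≡⟨ count+count (λ i → p i ∧ q i) (λ i → p i ∧ not (q i)) ⟩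
  ∑[ i < m ] (𝟙 (p i ∧ q i) + 𝟙 (p i ∧ not (q i)))         ≡⟨ sum-cong-≗ (λ i → split (p i) (q i)) ⟩
  ∑[ i < m ] 𝟙 (p i)                                        ≡⟨ count≡∑𝟙 p ⟨
  count p                                                   ∎
  where
  open ≡-Reasoning
  split : ∀ a b → 𝟙 (a ∧ b) + 𝟙 (a ∧ not b) ≡ 𝟙 a
  split false _     = refl
  split true  true  = refl
  split true  false = refl

count-∨ : {p q : Fin m → Bool} → (∀ {i} → T (p i) → ¬ T (q i)) →
          count (λ i → p i ∨ q i) ≡ count p + count q
count-∨ {m} {p} {q} disjoint = begin
  count (λ i → p i ∨ q i)          ≡⟨ count≡∑𝟙 (λ i → p i ∨ q i) ⟩
  ∑[ i < m ] 𝟙 (p i ∨ q i)         ≡⟨ sum-cong-≗ (λ i → 𝟙-∨ (p i) (q i) disjoint) ⟩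
  ∑[ i < m ] (𝟙 (p i) + 𝟙 (q i))   ≡⟨ count+count p q ⟨
  count p + count q                ∎
  where
  open ≡-Reasoning
  𝟙-∨ : ∀ a b → (T a → ¬ T b) → 𝟙 (a ∨ b) ≡ 𝟙 a + 𝟙 b
  𝟙-∨ false _     _  = refl
  𝟙-∨ true  false _  = refl
  𝟙-∨ true  true  ¬b = ⊥-elim (¬b _ _)

-- Double counting of the pairs (i, j) with p i, R i j and q j.
count-≤-via : {p : Fin m → Bool} {q : Fin m′ → Bool} (R : Fin m → Fin m′ → Bool) →
              (∀ {i} → T (p i) → ∃[ j ] T (R i j) × T (q j)) →
              (∀ {i i′ j} → T (p i) → T (p i′) → T (R i j) → T (R i′ j) → i ≡ i′) →
              count p ≤ count q
count-≤-via {m} {m′} {p} {q} R related unique = begin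
  count p                                ≡⟨ count≡∑𝟙 p ⟩
  ∑[ i < m ] 𝟙 (p i)                     ≤⟨ ∑-mono (λ i → 𝟙≤ (p i) (some-j i)) ⟩
  ∑[ i < m ] count (λ j → triple i j)    ≡⟨ sum-cong-≗ (λ i → count≡∑𝟙 (triple i)) ⟩
  ∑[ i < m ] ∑[ j < m′ ] 𝟙 (triple i j)  ≡⟨ ∑-comm (λ i j → 𝟙 (triple i j)) ⟩
  ∑[ j < m′ ] ∑[ i < m ] 𝟙 (triple i j)  ≡⟨ sum-cong-≗ (λ j → count≡∑𝟙 (λ i → triple i j)) ⟨
  ∑[ j < m′ ] count (λ i → triple i j)   ≤⟨ ∑-mono (λ j → ≤𝟙 (q j) (at-most-one-i j) (no-i j)) ⟩
  ∑[ j < m′ ] 𝟙 (q j)                    ≡⟨ count≡∑𝟙 q ⟨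
  count q                                ∎
  where
  open ≤-Reasoning
  triple : Fin m → Fin m′ → Bool
  triple i j = p i ∧ R i j ∧ q j

  𝟙≤ : ∀ b {n} → (T b → 1 ≤ n) → 𝟙 b ≤ n
  𝟙≤ false _ = z≤n
  𝟙≤ true  h = h _

  ≤𝟙 : ∀ b {n} → (T b → n ≤ 1) → (¬ T b → n ≡ 0) → n ≤ 𝟙 b
  ≤𝟙 false _ h = ≤-reflexive (h λ ())
  ≤𝟙 true  h _ = h _

  some-j : ∀ i → T (p i) → 1 ≤ count (triple i)
  some-j i pᵢ with j , Rᵢⱼ , qⱼ ← related pᵢ = ≤-count (triple i) j (∧-intro pᵢ (∧-intro Rᵢⱼ qⱼ))

  at-most-one-i : ∀ j → T (q j) → count (λ i → triple i j) ≤ 1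
  at-most-one-i j _ = count≤1 λ {i} {i′} t t′ →
    let pᵢ , Rq = ∧-elim (p i) t ; pᵢ′ , Rq′ = ∧-elim (p i′) t′
    in unique pᵢ pᵢ′ (proj₁ (∧-elim (R i j) Rq)) (proj₁ (∧-elim (R i′ j) Rq′))

  no-i : ∀ j → ¬ T (q j) → count (λ i → triple i j) ≡ 0
  no-i j ¬qⱼ = count≡0 (λ i → triple i j) λ {i} t → ¬qⱼ (proj₂ (∧-elim (R i j) (proj₂ (∧-elim (p i) t))))

indeg outdeg : (Fin m → Fin m → Bool) → Fin m → ℕ
indeg R z = count (λ x → R x z)
outdeg R z = count (R z)

∑-count-charge : (A G : Fin m → Fin m → Bool) →
                 ∑[ x < m ] count (A x)
                   ≡ ∑[ z < m ] (count (λ y → A z y ∧ not (G z y)) + count (λ x → A x z ∧ G x z))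
∑-count-charge {m} A G = begin
  ∑[ x < m ] count (A x)
    ≡⟨ sum-cong-≗ (λ x → sym (count-∧-split (A x) (G x))) ⟩
  ∑[ x < m ] (count (λ y → A x y ∧ G x y) + unused x)
    ≡⟨ sum-cong-≗ (λ x → +-comm (count (λ y → A x y ∧ G x y)) (unused x)) ⟩
  ∑[ x < m ] (unused x + count (λ y → A x y ∧ G x y))
    ≡⟨ ∑-distrib-+ unused (λ x → count (λ y → A x y ∧ G x y)) ⟩
  ∑[ x < m ] unused x + ∑[ x < m ] count (λ y → A x y ∧ G x y)
    ≡⟨ cong (∑[ x < m ] unused x +_) used-swap ⟩
  ∑[ z < m ] unused z + ∑[ z < m ] count (λ x → A x z ∧ G x z)
    ≡⟨ ∑-distrib-+ unused (λ z → count (λ x → A x z ∧ G x z)) ⟨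
  ∑[ z < m ] (unused z + count (λ x → A x z ∧ G x z)) ∎
  where
  open ≡-Reasoning
  unused : Fin m → ℕ
  unused z = count (λ y → A z y ∧ not (G z y))
  used-swap : ∑[ x < m ] count (λ y → A x y ∧ G x y) ≡ ∑[ z < m ] count (λ x → A x z ∧ G x z)
  used-swap = begin
    ∑[ x < m ] count (λ y → A x y ∧ G x y)     ≡⟨ sum-cong-≗ (λ x → count≡∑𝟙 (λ y → A x y ∧ G x y)) ⟩
    ∑[ x < m ] ∑[ y < m ] 𝟙 (A x y ∧ G x y)   ≡⟨ ∑-comm (λ x y → 𝟙 (A x y ∧ G x y)) ⟩
    ∑[ y < m ] ∑[ x < m ] 𝟙 (A x y ∧ G x y)   ≡⟨ sum-cong-≗ (λ z → count≡∑𝟙 (λ x → A x z ∧ G x z)) ⟨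
    ∑[ z < m ] count (λ x → A x z ∧ G x z)     ∎

∑-indeg*outdeg≤paths : (A B : Fin m → Fin m → Bool) →
                 ∑[ z < m ] (indeg A z * outdeg B z)
                   ≤ ∑[ x < m ] ∑[ z < m ] ∑[ z′ < m ] count (λ y → A x z ∧ B z′ y ∧ (z == z′))
∑-indeg*outdeg≤paths {m} A B = begin
  ∑[ z < m ] (count (λ x → A x z) * count (B z))
    ≡⟨ sum-cong-≗ (λ z → trans (cong (_* count (B z)) (count≡∑𝟙 (λ x → A x z)))
                               (*-distribʳ-sum (count (B z)) (λ x → 𝟙 (A x z)))) ⟩
  ∑[ z < m ] ∑[ x < m ] (𝟙 (A x z) * count (B z))
    ≡⟨ ∑-comm (λ z x → 𝟙 (A x z) * count (B z)) ⟩
  ∑[ x < m ] ∑[ z < m ] (𝟙 (A x z) * count (B z))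
    ≤⟨ ∑-mono (λ x → ∑-mono (λ z → ≤-trans (path-through x z) (≤-∑ _ z))) ⟩
  ∑[ x < m ] ∑[ z < m ] ∑[ z′ < m ] count (λ y → A x z ∧ B z′ y ∧ (z == z′)) ∎
  where
  open ≤-Reasoning
  path-through : ∀ x z → 𝟙 (A x z) * count (B z) ≤ count (λ y → A x z ∧ B z y ∧ (z == z))
  path-through x z with A x z
  ... | false = z≤n
  ... | true  = ≤-trans (≤-reflexive (+-identityʳ _)) (count-mono {p = B z} λ Bzy → ∧-intro Bzy (≡⇒== refl))

-- The cyclic successor

suc%-cases : ∀ {a N} → a ≤ N → (suc a ≤ N × suc a % suc N ≡ suc a) ⊎ (a ≡ N × suc a % suc N ≡ 0)
suc%-cases {a} {N} a≤N with m≤n⇒m<n∨m≡n a≤N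
... | inj₁ a<N  = inj₁ (a<N , m≤n⇒m%n≡m a<N)
... | inj₂ refl = inj₂ (refl , n%n≡0 (suc N))

suc%-injective : ∀ {a b N} → a ≤ N → b ≤ N → suc a % suc N ≡ suc b % suc N → a ≡ b
suc%-injective a≤N b≤N eq with suc%-cases a≤N | suc%-cases b≤N
... | inj₁ (_ , ≡a) | inj₁ (_ , ≡b) = suc-injective (trans (sym ≡a) (trans eq ≡b))
... | inj₂ (refl , _) | inj₂ (refl , _) = refl
... | inj₁ (_ , ≡a) | inj₂ (_ , ≡0) with () ← trans (sym ≡a) (trans eq ≡0)
... | inj₂ (_ , ≡0) | inj₁ (_ , ≡b) with () ← trans (sym ≡b) (trans (sym eq) ≡0)

next-injective : {a b : Fin m} → next a ≡ next b → a ≡ b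
next-injective {suc N} {a} {b} eq = Fin.toℕ-injective (suc%-injective (Fin.toℕ≤pred[n] a) (Fin.toℕ≤pred[n] b) (begin
  suc (toℕ a) % suc N  ≡⟨ Fin.toℕ-fromℕ< _ ⟨
  toℕ (next a)         ≡⟨ cong toℕ eq ⟩
  toℕ (next b)         ≡⟨ Fin.toℕ-fromℕ< _ ⟩
  suc (toℕ b) % suc N  ∎))
  where open ≡-Reasoning

-- The semi-random process

module _ {n t : ℕ} (u v : Fin t → Fin n) where
  open Process u v

  squareBefore : Fin n → Fin t → Bool
  squareBefore x i = any (λ j → (j <ᵇ i) ∧ (u j == x)) (allFin t)

  -- inW1 x y is by definition any (W1-step x y) (allFin t), and likewise for inW2.
  W1-step W2-step : Fin n → Fin n → Fin t → Bool
  W1-step x y i = notLast i ∧ (u i == x) ∧ (v i == y)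
                  ∧ not (squareBefore x i)
                  ∧ ⌊ after i x ℕ.≟ 0 ⌋
                  ∧ atLeast2 (after i y)
  W2-step x y i = notLast i ∧ (u i == x) ∧ (v i == y)
                  ∧ ⌊ Zx x ℕ.≟ 2 ⌋
                  ∧ atLeast2 (after i y)

  after≤Zx : ∀ i y → after i y ≤ Zx y
  after≤Zx i y = count-mono λ {j} sq → proj₂ (∧-elim (i <ᵇ j) sq)

  Zx≤1 : ∀ {x} i → ¬ T (squareBefore x i) → after i x ≡ 0 → Zx x ≤ 1
  Zx≤1 {x} i none-before none-after =
    count≤1 λ {j} {j′} sqⱼ sqⱼ′ → trans (only-i j (==⇒≡ sqⱼ)) (sym (only-i j′ (==⇒≡ sqⱼ′)))
    where
    only-i : ∀ j → u j ≡ x → j ≡ i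
    only-i j uⱼ≡x with <-cmp (toℕ j) (toℕ i)
    ... | tri< j<i _ _ = ⊥-elim (none-before (any-allFin⁺ _ j (∧-intro (fromWitness j<i) (≡⇒== uⱼ≡x))))
    ... | tri≈ _ j≡i _ = Fin.toℕ-injective j≡i
    ... | tri> _ _ i<j = ⊥-elim (count≡0⇒¬ _ none-after j (∧-intro (fromWitness i<j) (≡⇒== uⱼ≡x)))

  W1-step⇒ : ∀ {x y i} → T (W1-step x y i) → (u i ≡ x × v i ≡ y) × Zx x ≤ 1 × 2 ≤ Zx y
  W1-step⇒ {x} {y} {i} s₀ =
    let _          , s₁      = ∧-elim (notLast i) s₀
        uᵢ≡x       , s₂      = ∧-elim (u i == x) s₁
        vᵢ≡y       , s₃      = ∧-elim (v i == y) s₂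
        first      , s₄      = ∧-elim (not (squareBefore x i)) s₃
        none-after , 2≤after = ∧-elim ⌊ after i x ℕ.≟ 0 ⌋ s₄
    in (==⇒≡ uᵢ≡x , ==⇒≡ vᵢ≡y)
     , Zx≤1 i (not⁻ _ first) (toWitness none-after)
     , ≤-trans (toWitness 2≤after) (after≤Zx i y)

  W2-step⇒ : ∀ {x y i} → T (W2-step x y i) → (u i ≡ x × v i ≡ y) × Zx x ≡ 2 × 2 ≤ Zx y
  W2-step⇒ {x} {y} {i} s₀ =
    let _      , s₁      = ∧-elim (notLast i) s₀
        uᵢ≡x   , s₂      = ∧-elim (u i == x) s₁
        vᵢ≡y   , s₃      = ∧-elim (v i == y) s₂
        Zx≡2   , 2≤after = ∧-elim ⌊ Zx x ℕ.≟ 2 ⌋ s₃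
    in (==⇒≡ uᵢ≡x , ==⇒≡ vᵢ≡y) , toWitness Zx≡2 , ≤-trans (toWitness 2≤after) (after≤Zx i y)

  inW1⇒ : ∀ {x y} → T (inW1 x y) → Zx x ≤ 1 × 2 ≤ Zx y
  inW1⇒ {x} {y} p = let i , s = any-allFin⁻ (W1-step x y) p in proj₂ (W1-step⇒ s)

  inW2⇒ : ∀ {x y} → T (inW2 x y) → Zx x ≡ 2 × 2 ≤ Zx y
  inW2⇒ {x} {y} p = let i , s = any-allFin⁻ (W2-step x y) p in proj₂ (W2-step⇒ s)

  -- At a vertex with Z_z = k: s squares of H, b₁ and b₂ unused W₁- and W₂-pairs leaving it,
  -- g used pairs entering it, I incoming pairs and O outgoing W₂-pairs.
  charge-bound : ∀ k s b₁ b₂ g I O →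
                 s + b₁ ≤ k → s + b₂ ≤ k → s + g ≤ 2 → g ≤ I → b₂ ≤ O →
                 (k ≤ 1 → g ≡ 0) → (2 ≤ k → b₁ ≡ 0) → (k ≢ 2 → b₂ ≡ 0) →
                 s + b₁ + b₂ + g ≤ zval k + I * O
  charge-bound 0 s b₁ b₂ g I O s+b₁≤0 _ _ _ _ g≡0 _ b₂≡0
    rewrite g≡0 z≤n | b₂≡0 (λ ()) | +-identityʳ (s + b₁) | +-identityʳ (s + b₁) = m≤n⇒m≤n+o (I * O) s+b₁≤0
  charge-bound 1 s b₁ b₂ g I O s+b₁≤1 _ _ _ _ g≡0 _ b₂≡0
    rewrite g≡0 (s≤s z≤n) | b₂≡0 (λ ()) | +-identityʳ (s + b₁) | +-identityʳ (s + b₁) = m≤n⇒m≤n+o (I * O) s+b₁≤1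
  charge-bound 2 s b₁ b₂ g I O _ s+b₂≤2 s+g≤2 g≤I b₂≤O _ b₁≡0 _ rewrite b₁≡0 (s≤s (s≤s z≤n)) | +-identityʳ s =
    exactly-two b₂ g s+b₂≤2 s+g≤2 g≤I b₂≤O
    where
    exactly-two : ∀ b₂ g → s + b₂ ≤ 2 → s + g ≤ 2 → g ≤ I → b₂ ≤ O → s + b₂ + g ≤ 2 + I * O
    exactly-two b₂ 0 s+b₂≤2 _ _ _ = m≤n⇒m≤n+o (I * O) (≤-trans (≤-reflexive (+-identityʳ (s + b₂))) s+b₂≤2)
    exactly-two 0 g _ s+g≤2 _ _ = m≤n⇒m≤n+o (I * O) (≤-trans (≤-reflexive (cong (_+ g) (+-identityʳ s))) s+g≤2)
    exactly-two b₂@(suc _) g@(suc _) s+b₂≤2 _ g≤I b₂≤O = begin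
      s + b₂ + g  ≤⟨ +-monoˡ-≤ g s+b₂≤2 ⟩
      2 + g       ≤⟨ +-monoʳ-≤ 2 (≤-trans (m≤m*n g b₂) (*-mono-≤ g≤I b₂≤O)) ⟩
      2 + I * O   ∎
      where open ≤-Reasoning
  charge-bound (suc (suc (suc _))) s b₁ b₂ g I O _ _ s+g≤2 _ _ _ b₁≡0 b₂≡0
    rewrite b₁≡0 (s≤s (s≤s z≤n)) | b₂≡0 (λ ()) | +-identityʳ s | +-identityʳ s =
    m≤n⇒m≤n+o (I * O) s+g≤2

  indeg₁≡0 : ∀ {z} → Zx z ≤ 1 → indeg inW1 z ≡ 0
  indeg₁≡0 {z} Zz≤1 = count≡0 (λ x → inW1 x z) λ p → ≤⇒≯ Zz≤1 (proj₂ (inW1⇒ p))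

  indeg₂≡0 : ∀ {z} → Zx z ≤ 1 → indeg inW2 z ≡ 0
  indeg₂≡0 {z} Zz≤1 = count≡0 (λ x → inW2 x z) λ p → ≤⇒≯ Zz≤1 (proj₂ (inW2⇒ p))

  outdeg₁≡0 : ∀ {z} → 2 ≤ Zx z → outdeg inW1 z ≡ 0
  outdeg₁≡0 {z} 2≤Zz = count≡0 (inW1 z) λ p → ≤⇒≯ (proj₁ (inW1⇒ p)) 2≤Zz

  outdeg₂≡0 : ∀ {z} → Zx z ≢ 2 → outdeg inW2 z ≡ 0
  outdeg₂≡0 {z} Zz≢2 = count≡0 (inW2 z) λ p → Zz≢2 (proj₁ (inW2⇒ p))

  countQuads≡∑ : (p : Fin n → Fin n → Fin n → Fin n → Bool) →
                 countQuads p ≡ ∑[ x₁ < n ] ∑[ y₁ < n ] ∑[ x₂ < n ] count (p x₁ y₁ x₂)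
  countQuads≡∑ p =
    trans (sum-map-allFin λ x₁ → sum (map (λ y₁ → sum (map (λ x₂ → count (p x₁ y₁ x₂)) (allFin n))) (allFin n)))
          (sum-cong-≗ λ x₁ → trans (sum-map-allFin λ y₁ → sum (map (λ x₂ → count (p x₁ y₁ x₂)) (allFin n)))
                                   (sum-cong-≗ λ y₁ → sum-map-allFin λ x₂ → count (p x₁ y₁ x₂)))

  ∑-indeg*outdeg≤countQuads : (A B : Fin n → Fin n → Bool) →
                              ∑[ z < n ] (indeg A z * outdeg B z)
                                ≤ countQuads (λ x₁ y₁ x₂ y₂ → A x₁ y₁ ∧ B x₂ y₂ ∧ (y₁ == x₂))
  ∑-indeg*outdeg≤countQuads A B = ≤-trans (∑-indeg*outdeg≤paths A B) (≤-reflexive (sym (countQuads≡∑ _)))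

  module Cycle (H : HamCycle u v) where
    open HamCycle H

    squaresOn circlesOn : Fin n → ℕ
    squaresOn z = count (λ k → u (e k) == z)
    circlesOn z = count (λ k → v (e k) == z)

    squaresOn+circlesOn≤2 : ∀ z → squaresOn z + circlesOn z ≤ 2
    squaresOn+circlesOn≤2 z = begin
      squaresOn z + circlesOn z
        ≡⟨ count+count (λ k → u (e k) == z) (λ k → v (e k) == z) ⟩
      ∑[ k < n ] (𝟙 (u (e k) == z) + 𝟙 (v (e k) == z))
        ≡⟨ sum-cong-≗ (λ k → endpoints (e-ok k)) ⟩
      ∑[ k < n ] (𝟙 (w k == z) + 𝟙 (w (next k) == z))
        ≡⟨ count+count (λ k → w k == z) (λ k → w (next k) == z) ⟨
      count (λ k → w k == z) + count (λ k → w (next k) == z)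
        ≤⟨ +-mono-≤ (count≤1 λ wₖ wₗ → w-inj (trans (==⇒≡ wₖ) (sym (==⇒≡ wₗ))))
                    (count≤1 λ wₖ wₗ → next-injective (w-inj (trans (==⇒≡ wₖ) (sym (==⇒≡ wₗ))))) ⟩
      2 ∎
      where
      open ≤-Reasoning
      endpoints : ∀ {i a b} → joins i a b → 𝟙 (u i == z) + 𝟙 (v i == z) ≡ 𝟙 (a == z) + 𝟙 (b == z)
      endpoints (inj₁ (refl , refl)) = refl
      endpoints {i} (inj₂ (refl , refl)) = +-comm (𝟙 (u i == z)) (𝟙 (v i == z))

    inH : Fin t → Bool
    inH i = any (λ k → e k == i) (allFin n)

    module Charging (P : Fin n → Fin n → Fin t → Bool)
                    (P⇒edge : ∀ {x y i} → T (P x y i) → u i ≡ x × v i ≡ y) where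

      inW usedByH : Fin n → Fin n → Bool
      inW x y = any (P x y) (allFin t)
      usedByH x y = any (λ k → P x y (e k)) (allFin n)

      unusedFrom usedInto : Fin n → ℕ
      unusedFrom z = count (λ y → inW z y ∧ not (usedByH z y))
      usedInto z = count (λ x → inW x z ∧ usedByH x z)

      countPairs-charged : countPairs inW ≡ ∑[ z < n ] (unusedFrom z + usedInto z)
      countPairs-charged = trans (sum-map-allFin (λ x → count (inW x))) (∑-count-charge inW usedByH)

      usedByH⇒edge : ∀ {x y} → T (usedByH x y) → ∃[ k ] u (e k) ≡ x × v (e k) ≡ y
      usedByH⇒edge {x} {y} used = let k , P-eₖ = any-allFin⁻ (λ k → P x y (e k)) used in k , P⇒edge P-eₖ

      unused-outside-H : ∀ {x y i} → T (P x y i) → ¬ T (usedByH x y) → ¬ T (inH i)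
      unused-outside-H {x} {y} {i} Pᵢ unused inHᵢ =
        let k , eₖ≡i = any-allFin⁻ (λ k → e k == i) inHᵢ
        in unused (any-allFin⁺ (λ k → P x y (e k)) k (subst (T ∘ P x y) (sym (==⇒≡ eₖ≡i)) Pᵢ))

      squaresOn+unusedFrom≤Zx : ∀ z → squaresOn z + unusedFrom z ≤ Zx z
      squaresOn+unusedFrom≤Zx z = begin
        squaresOn z + unusedFrom z
          ≤⟨ +-mono-≤ squaresOn≤ unusedFrom≤ ⟩
        count (λ i → (u i == z) ∧ inH i) + count (λ i → (u i == z) ∧ not (inH i))
          ≡⟨ count-∧-split (λ i → u i == z) inH ⟩
        Zx z ∎
        where
        open ≤-Reasoning
        squaresOn≤ : squaresOn z ≤ count (λ i → (u i == z) ∧ inH i)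
        squaresOn≤ = count-≤-via (λ k i → e k == i)
          (λ {k} sq → e k , ≡⇒== refl , ∧-intro sq (any-allFin⁺ _ k (≡⇒== refl)))
          (λ _ _ eₖ eₗ → e-inj (trans (==⇒≡ eₖ) (sym (==⇒≡ eₗ))))
        unusedFrom≤ : unusedFrom z ≤ count (λ i → (u i == z) ∧ not (inH i))
        unusedFrom≤ = count-≤-via (P z)
          (λ {y} p → let inW-zy , unused = ∧-elim (inW z y) p
                         i , Pᵢ = any-allFin⁻ (P z y) inW-zy
                     in i , Pᵢ , ∧-intro (≡⇒== (proj₁ (P⇒edge Pᵢ))) (not⁺ (unused-outside-H Pᵢ (not⁻ _ unused))))
          (λ _ _ Pᵢ Pᵢ′ → trans (sym (proj₂ (P⇒edge Pᵢ))) (proj₂ (P⇒edge Pᵢ′)))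

      unusedFrom≤outdeg : ∀ z → unusedFrom z ≤ outdeg inW z
      unusedFrom≤outdeg z = count-mono λ {y} p → proj₁ (∧-elim (inW z y) p)

      usedInto≤indeg : ∀ z → usedInto z ≤ indeg inW z
      usedInto≤indeg z = count-mono λ {x} p → proj₁ (∧-elim (inW x z) p)


    module C₁ = Charging W1-step (λ s → proj₁ (W1-step⇒ s))
    module C₂ = Charging W2-step (λ s → proj₁ (W2-step⇒ s))

    usedInto≤circlesOn : ∀ z → C₁.usedInto z + C₂.usedInto z ≤ circlesOn z
    usedInto≤circlesOn z = begin
      C₁.usedInto z + C₂.usedInto z          ≡⟨ count-∨ {p = used₁} {q = used₂} disjoint ⟨
      count (λ x → used₁ x ∨ used₂ x)        ≤⟨ count-≤-via (λ x k → u (e k) == x) edge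
                                                  (λ _ _ uₖ uₖ′ → trans (sym (==⇒≡ uₖ)) (==⇒≡ uₖ′)) ⟩
      circlesOn z                            ∎
      where
      open ≤-Reasoning
      used₁ used₂ : Fin n → Bool
      used₁ x = inW1 x z ∧ C₁.usedByH x z
      used₂ x = inW2 x z ∧ C₂.usedByH x z
      disjoint : ∀ {x} → T (used₁ x) → ¬ T (used₂ x)
      disjoint {x} p q = ≤⇒≯ (proj₁ (inW1⇒ (proj₁ (∧-elim (inW1 x z) p))))
                             (≤-reflexive (sym (proj₁ (inW2⇒ (proj₁ (∧-elim (inW2 x z) q))))))
      edge : ∀ {x} → T (used₁ x ∨ used₂ x) → ∃[ k ] T (u (e k) == x) × T (v (e k) == z)
      edge {x} p with ∨-elim (used₁ x) p
      ... | inj₁ p₁ = let k , uₖ , vₖ = C₁.usedByH⇒edge (proj₂ (∧-elim (inW1 x z) p₁)) in k , ≡⇒== uₖ , ≡⇒== vₖ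
      ... | inj₂ p₂ = let k , uₖ , vₖ = C₂.usedByH⇒edge (proj₂ (∧-elim (inW2 x z) p₂)) in k , ≡⇒== uₖ , ≡⇒== vₖ

    vertex-charge-bound : ∀ z → squaresOn z + (C₁.unusedFrom z + C₁.usedInto z) + (C₂.unusedFrom z + C₂.usedInto z)
                     ≤ zval (Zx z) + indeg inW1 z * outdeg inW2 z + indeg inW2 z * outdeg inW2 z
    vertex-charge-bound z = begin
      s + (b₁ + g₁) + (b₂ + g₂)        ≡⟨ rearrange s b₁ g₁ b₂ g₂ ⟩
      s + b₁ + b₂ + (g₁ + g₂)          ≤⟨ charge-bound (Zx z) s b₁ b₂ (g₁ + g₂) (I₁ + I₂) O
                                            (C₁.squaresOn+unusedFrom≤Zx z) (C₂.squaresOn+unusedFrom≤Zx z)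
                                            s+g≤2 g≤I (C₂.unusedFrom≤outdeg z) g≡0 b₁≡0 b₂≡0 ⟩
      zval (Zx z) + (I₁ + I₂) * O      ≡⟨ cong (zval (Zx z) +_) (*-distribʳ-+ O I₁ I₂) ⟩
      zval (Zx z) + (I₁ * O + I₂ * O)  ≡⟨ +-assoc (zval (Zx z)) (I₁ * O) (I₂ * O) ⟨
      zval (Zx z) + I₁ * O + I₂ * O    ∎
      where
      open ≤-Reasoning
      s = squaresOn z
      b₁ = C₁.unusedFrom z
      g₁ = C₁.usedInto z
      b₂ = C₂.unusedFrom z
      g₂ = C₂.usedInto z
      I₁ = indeg inW1 z
      I₂ = indeg inW2 z
      O = outdeg inW2 z
      rearrange : ∀ a b c d e → a + (b + c) + (d + e) ≡ a + b + d + (c + e)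
      rearrange = solve-∀
      s+g≤2 : s + (g₁ + g₂) ≤ 2
      s+g≤2 = ≤-trans (+-monoʳ-≤ s (usedInto≤circlesOn z)) (squaresOn+circlesOn≤2 z)
      g≤I : g₁ + g₂ ≤ I₁ + I₂
      g≤I = +-mono-≤ (C₁.usedInto≤indeg z) (C₂.usedInto≤indeg z)
      g≡0 : Zx z ≤ 1 → g₁ + g₂ ≡ 0
      g≡0 Zz≤1 = n≤0⇒n≡0 (subst (g₁ + g₂ ≤_) (cong₂ _+_ (indeg₁≡0 Zz≤1) (indeg₂≡0 Zz≤1)) g≤I)
      b₁≡0 : 2 ≤ Zx z → b₁ ≡ 0
      b₁≡0 2≤Zz = n≤0⇒n≡0 (subst (b₁ ≤_) (outdeg₁≡0 2≤Zz) (C₁.unusedFrom≤outdeg z))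
      b₂≡0 : Zx z ≢ 2 → b₂ ≡ 0
      b₂≡0 Zz≢2 = n≤0⇒n≡0 (subst (b₂ ≤_) (outdeg₂≡0 Zz≢2) (C₂.unusedFrom≤outdeg z))

claim3p1 : (n t : ℕ) → 1 ≤ t →
           (u v : Fin t → Fin n) → (∀ i → u i ≢ v i) →
           (H : HamCycle u v) →
           squaresUsed H + Process.W1size u v + Process.W2size u v
             ≤ Process.Z u v + Process.W u v
claim3p1 n t _ u v _ H = begin
  squaresUsed H + W1size + W2size
    ≡⟨ cong₂ _+_ (cong₂ _+_ (sum-map-allFin squaresOn) C₁.countPairs-charged) C₂.countPairs-charged ⟩
  ∑[ z < n ] squaresOn z + ∑[ z < n ] (b₁ z + g₁ z) + ∑[ z < n ] (b₂ z + g₂ z)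
    ≡⟨ ∑-distrib-+₃ squaresOn (λ z → b₁ z + g₁ z) (λ z → b₂ z + g₂ z) ⟨
  ∑[ z < n ] (squaresOn z + (b₁ z + g₁ z) + (b₂ z + g₂ z))
    ≤⟨ ∑-mono vertex-charge-bound ⟩
  ∑[ z < n ] (zval (Zx z) + indeg inW1 z * outdeg inW2 z + indeg inW2 z * outdeg inW2 z)
    ≡⟨ ∑-distrib-+₃ (zval ∘ Zx) (λ z → indeg inW1 z * outdeg inW2 z) (λ z → indeg inW2 z * outdeg inW2 z) ⟩
  ∑[ z < n ] zval (Zx z) + ∑[ z < n ] (indeg inW1 z * outdeg inW2 z) + ∑[ z < n ] (indeg inW2 z * outdeg inW2 z)
    ≤⟨ +-mono-≤ (+-mono-≤ (≤-reflexive (sym (sum-map-allFin (zval ∘ Zx))))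
                          (∑-indeg*outdeg≤countQuads u v inW1 inW2))
                (∑-indeg*outdeg≤countQuads u v inW2 inW2) ⟩
  Z + T1size + T2size
    ≡⟨ +-assoc Z T1size T2size ⟩
  Z + W ∎
  where
  open ≤-Reasoning
  open Process u v
  open Cycle u v H
  b₁ g₁ b₂ g₂ : Fin n → ℕ
  b₁ = C₁.unusedFrom
  g₁ = C₁.usedInto
  b₂ = C₂.unusedFrom
  g₂ = C₂.usedInto
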